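{- Let $R$ be a finite unital ring and $U$ a subgroup of $R^\times$ with $-1\in U$. Suppose $\Gamma(R,U)$ is connected and anti-connected, but not prime. Then $0$ is an eigenvalue of the adjacency matrix of $\Gamma(R,U)$.
   Context: The Cayley graph $\Gamma(R,U)$ has vertex set $R$, with $a,b$ adjacent iff $a-b\in U$. Anti-connected means the complement is connected. A vertex subset $X$ is homogeneous if every vertex outside $X$ is adjacent to all or none of $X$; non-trivial if $2\le|X|<|V|$; a graph is prime if it has no non-trivial homogeneous set. -}

module Defs where

open import Level using (0ℓ)
open import Data.Nat using (ℕ; _≤_; _<_)
open import Data.Fin using (Fin)
open import Data.Fin.Subset using (Subset; _∈_; _∉_; ∣_∣)
open import Data.Fin.Subset.Properties using (_∈?_)
open import Data.Product using (Σ; ∃; _×_; _,_)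
open import Data.Sum using (_⊎_)
open import Data.Bool using (if_then_else_)
open import Relation.Nullary using (¬_; does)
open import Relation.Binary.PropositionalEquality using (_≡_; _≢_)
open import Relation.Binary.Construct.Closure.ReflexiveTransitive using (Star)
open import Algebra.Core using (Op₁; Op₂)
open import Algebra.Structures using (IsRing)
open import Data.Rational using (ℚ; 0ℚ; 1ℚ) renaming (_+_ to _+ℚ_; _*_ to _*ℚ_)
open import Data.Vec.Functional using (foldr)

-- A finite unital ring with n elements, presented on the carrier Fin n
-- (every finite ring is isomorphic to one of this form), with
-- propositional equality as the ring equality.
record FiniteRing (n : ℕ) : Set where
  field
    _+_ : Op₂ (Fin n)
    _*_ : Op₂ (Fin n)
    -_  : Op₁ (Fin n)
    0#  : Fin n
    1#  : Fin n
    isRing : IsRing _≡_ _+_ _*_ -_ 0# 1#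

  infixl 6 _+_
  infixl 7 _*_

  _-_ : Op₂ (Fin n)
  a - b = a + (- b)

  IsUnit : Fin n → Set
  IsUnit u = Σ (Fin n) λ v → (u * v ≡ 1#) × (v * u ≡ 1#)

  record IsUnitSubgroup (U : Subset n) : Set where
    field
      units   : ∀ u → u ∈ U → IsUnit u
      one∈    : 1# ∈ U
      mul∈    : ∀ u v → u ∈ U → v ∈ U → u * v ∈ U
      inv∈    : ∀ u v → u ∈ U → u * v ≡ 1# → v * u ≡ 1# → v ∈ U

module _ {n : ℕ} (R : FiniteRing n) (U : Subset n) where
  open FiniteRing R

  Adj : Fin n → Fin n → Set
  Adj a b = (a - b) ∈ U

  CoAdj : Fin n → Fin n → Set
  CoAdj a b = (a ≢ b) × ¬ Adj a b

  Connected : Set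
  Connected = ∀ a b → Star Adj a b

  AntiConnected : Set
  AntiConnected = ∀ a b → Star CoAdj a b

  Homogeneous : Subset n → Set
  Homogeneous X = ∀ v → v ∉ X →
    (∀ x → x ∈ X → Adj v x) ⊎ (∀ x → x ∈ X → ¬ Adj v x)

  NonTrivial : Subset n → Set
  NonTrivial X = (2 ≤ ∣ X ∣) × (∣ X ∣ < n)

  Prime : Set
  Prime = ¬ (Σ (Subset n) λ X → Homogeneous X × NonTrivial X)

  adjMatrix : Fin n → Fin n → ℚ
  adjMatrix a b = if does ((a - b) ∈? U) then 1ℚ else 0ℚ

  adjMul : (Fin n → ℚ) → Fin n → ℚ
  adjMul v a = foldr _+ℚ_ 0ℚ (λ b → adjMatrix a b *ℚ v b)

  ZeroIsEigenvalue : Set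
  ZeroIsEigenvalue = Σ (Fin n → ℚ) λ v →
    (∃ λ i → v i ≢ 0ℚ) × (∀ a → adjMul v a ≡ 0ℚ)

{-# OPTIONS --safe #-}
-- Translate a nontrivial homogeneous set X so that 0 ∈ X. As long as X is not
-- closed under addition and under multiplication by U, some translate X + m or
-- some image uX (m ∈ X, u ∈ U) is a homogeneous set meeting X but not inside it;
-- the union of the two is again homogeneous, and it is still proper because in a
-- connected and anti-connected graph two proper homogeneous sets never cover all
-- vertices. The process ends with a proper homogeneous set M ∋ 0 closed under +
-- and under U. Such an M contains no unit (connectedness would give M = R), so for
-- d ≠ 0 in M no vertex of M is adjacent to 0 or d, while homogeneity treats 0 and
-- d alike outside M. Hence 0 and d are twins and e₀ - e_d is in the kernel of the
-- adjacency matrix.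

module Submission where

open import Defs
open import Level using (0ℓ)
open import Data.Nat using (ℕ; zero; suc; _≤_; _<_; _≤?_; _<?_; s≤s; z≤n)
import Data.Nat.Properties as ℕP
open import Data.Fin using (Fin; _≟_)
import Data.Fin as Fin
open import Data.Fin.Subset using (Subset; _∈_; _∉_; ∣_∣; _∪_; _⊆_; ⁅_⁆; Nonempty)
open import Data.Fin.Subset.Properties
  using ( _∈?_; nonempty?; Empty-unique; ∣⊥∣≡0; ∣p∣≤n; ∣∁p∣≡n∸∣p∣; x∈∁p⇒x∉p
        ; x∈⁅x⁆; ∣⁅x⁆∣≡1; p⊆q⇒∣p∣≤∣q∣; p⊂q⇒∣p∣<∣q∣; p⊆p∪q; x∈p∪q⁺; x∈p∪q⁻
        ; anySubset? )
open import Data.Fin.Properties using (any?; all?)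
open import Data.Vec using (lookup; tabulate)
open import Data.Vec.Properties using (lookup∘tabulate; []=⇒lookup; lookup⇒[]=)
open import Data.Product using (∃; _×_; _,_)
open import Data.Sum using (_⊎_; inj₁; inj₂; [_,_]′)
open import Data.Empty using (⊥; ⊥-elim)
open import Data.Bool using (if_then_else_)
open import Function using (_∘_; id; _⇔_; mk⇔)
open import Relation.Nullary using (¬_; Dec; yes; no; contradiction)
open import Relation.Nullary.Decidable
  using (¬?; _×-dec_; _⊎-dec_; _→-dec_; decidable-stable; does-⇔)
open import Relation.Binary.PropositionalEquality
open import Relation.Binary.Construct.Closure.ReflexiveTransitive using (Star; fold)
open import Algebra.Bundles using (Ring)
import Algebra.Properties.Ring as RingProperties
open import Data.Rational using (ℚ; 0ℚ; 1ℚ) renaming (_-_ to _-ℚ_)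
import Data.Rational.Properties as ℚP
open import Algebra.Properties.Semiring.Sum (Ring.semiring ℚP.+-*-ring)
  using (sum; sum-cong-≗; sum-replicate-zero; ∑-distrib-+; *-distribˡ-sum)

module _ where
  open import Data.Rational using (_+_; _*_; -_; _-_)
  open ≡-Reasoning

  δ : ∀ {m} → Fin m → Fin m → ℚ
  δ Fin.zero    Fin.zero    = 1ℚ
  δ Fin.zero    (Fin.suc _) = 0ℚ
  δ (Fin.suc _) Fin.zero    = 0ℚ
  δ (Fin.suc p) (Fin.suc b) = δ p b

  δ-diag : ∀ {m} (p : Fin m) → δ p p ≡ 1ℚ
  δ-diag Fin.zero    = refl
  δ-diag (Fin.suc p) = δ-diag p

  δ-off : ∀ {m} {p q : Fin m} → p ≢ q → δ p q ≡ 0ℚ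
  δ-off {p = Fin.zero}  {Fin.zero}  p≢q = contradiction refl p≢q
  δ-off {p = Fin.zero}  {Fin.suc _} _   = refl
  δ-off {p = Fin.suc _} {Fin.zero}  _   = refl
  δ-off {p = Fin.suc p} {Fin.suc q} p≢q = δ-off (p≢q ∘ cong Fin.suc)

  ∑-δ : ∀ {m} (f : Fin m → ℚ) p → sum (λ b → f b * δ p b) ≡ f p
  ∑-δ {suc m} f Fin.zero = begin
    f Fin.zero * 1ℚ + sum (λ b → f (Fin.suc b) * 0ℚ)
      ≡⟨ cong₂ _+_ (ℚP.*-identityʳ (f Fin.zero))
                   (trans (sum-cong-≗ (ℚP.*-zeroʳ ∘ f ∘ Fin.suc)) (sum-replicate-zero m)) ⟩
    f Fin.zero + 0ℚ
      ≡⟨ ℚP.+-identityʳ (f Fin.zero) ⟩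
    f Fin.zero ∎
  ∑-δ f (Fin.suc p) =
    trans (cong₂ _+_ (ℚP.*-zeroʳ (f Fin.zero)) (∑-δ (f ∘ Fin.suc) p)) (ℚP.+-identityˡ _)

  ∑-neg : ∀ {m} (f : Fin m → ℚ) → sum (λ b → - f b) ≡ - sum f
  ∑-neg f = begin
    sum (λ b → - f b)        ≡⟨ sum-cong-≗ (sym ∘ ℚRing.-1*x≈-x ∘ f) ⟩
    sum (λ b → - 1ℚ * f b)   ≡⟨ sym (*-distribˡ-sum (- 1ℚ) f) ⟩
    - 1ℚ * sum f             ≡⟨ ℚRing.-1*x≈-x (sum f) ⟩
    - sum f                  ∎
    where module ℚRing = RingProperties ℚP.+-*-ring

  ∑-δ-difference : ∀ {m} (f : Fin m → ℚ) p q → sum (λ b → f b * (δ p b - δ q b)) ≡ f p - f q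
  ∑-δ-difference f p q = begin
    sum (λ b → f b * (δ p b - δ q b))
      ≡⟨ sum-cong-≗ (λ b → ℚRing.x[y-z]≈xy-xz (f b) (δ p b) (δ q b)) ⟩
    sum (λ b → f b * δ p b - f b * δ q b)
      ≡⟨ ∑-distrib-+ (λ b → f b * δ p b) (λ b → - (f b * δ q b)) ⟩
    sum (λ b → f b * δ p b) + sum (λ b → - (f b * δ q b))
      ≡⟨ cong₂ _+_ (∑-δ f p) (trans (∑-neg (λ b → f b * δ q b)) (cong -_ (∑-δ f q))) ⟩
    f p - f q ∎
    where module ℚRing = RingProperties ℚP.+-*-ring

module _ {n : ℕ} (R : FiniteRing n) (U : Subset n) where
  open FiniteRing R using (_-_)

  twins⇒zeroIsEigenvalue : ∀ {p q} → p ≢ q → (∀ a → Adj R U a p ⇔ Adj R U a q) →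
                           ZeroIsEigenvalue R U
  twins⇒zeroIsEigenvalue {p} {q} p≢q twins = v , (p , v[p]≢0) , Av≡0
    where
      v : Fin n → ℚ
      v b = δ p b -ℚ δ q b

      v[p]≢0 : v p ≢ 0ℚ
      v[p]≢0 rewrite δ-diag p | δ-off (p≢q ∘ sym) = ℚP.1≢0

      Av≡0 : ∀ a → adjMul R U v a ≡ 0ℚ
      Av≡0 a = begin
        adjMul R U v a
          ≡⟨ ∑-δ-difference (adjMatrix R U a) p q ⟩
        adjMatrix R U a p -ℚ adjMatrix R U a q
          ≡⟨ cong (λ t → (if t then 1ℚ else 0ℚ) -ℚ adjMatrix R U a q)
                  (does-⇔ (twins a) ((a - p) ∈? U) ((a - q) ∈? U)) ⟩
        adjMatrix R U a q -ℚ adjMatrix R U a q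
          ≡⟨ ℚP.+-inverseʳ (adjMatrix R U a q) ⟩
        0ℚ ∎
        where open ≡-Reasoning

preimage : ∀ {n} → (Fin n → Fin n) → Subset n → Subset n
preimage f X = tabulate (lookup X ∘ f)

module _ {n} {f : Fin n → Fin n} {X : Subset n} {s : Fin n} where

  ∈-preimage⁺ : f s ∈ X → s ∈ preimage f X
  ∈-preimage⁺ fs∈X =
    lookup⇒[]= s _ (trans (lookup∘tabulate (lookup X ∘ f) s) ([]=⇒lookup fs∈X))

  ∈-preimage⁻ : s ∈ preimage f X → f s ∈ X
  ∈-preimage⁻ s∈f⁻¹X =
    lookup⇒[]= (f s) X (trans (sym (lookup∘tabulate (lookup X ∘ f) s)) ([]=⇒lookup s∈f⁻¹X))

module _ {n : ℕ} where

  0<∣p∣⇒nonempty : ∀ {p : Subset n} → 0 < ∣ p ∣ → Nonempty p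
  0<∣p∣⇒nonempty {p} 0<∣p∣ = decidable-stable (nonempty? p) λ empty →
    ℕP.<-irrefl (sym (trans (cong ∣_∣ (Empty-unique empty)) (∣⊥∣≡0 n))) 0<∣p∣

  ∣p∣<n⇒∃∉ : ∀ {p : Subset n} → ∣ p ∣ < n → ∃ λ x → x ∉ p
  ∣p∣<n⇒∃∉ {p} ∣p∣<n =
    let x , x∈∁p = 0<∣p∣⇒nonempty (subst (0 <_) (sym (∣∁p∣≡n∸∣p∣ p)) (ℕP.m<n⇒0<n∸m ∣p∣<n))
    in x , x∈∁p⇒x∉p x∈∁p

  1<∣p∣⇒∃≢ : ∀ {p : Subset n} → 1 < ∣ p ∣ → ∀ x → ∃ λ y → y ∈ p × y ≢ x
  1<∣p∣⇒∃≢ {p} 1<∣p∣ x = decidable-stable (any? λ y → y ∈? p ×-dec ¬? (y ≟ x)) λ none →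
    ℕP.<⇒≱ 1<∣p∣ (subst (∣ p ∣ ≤_) (∣⁅x⁆∣≡1 x) (p⊆q⇒∣p∣≤∣q∣ (p⊆⁅x⁆ none)))
    where
      p⊆⁅x⁆ : ¬ (∃ λ y → y ∈ p × y ≢ x) → p ⊆ ⁅ x ⁆
      p⊆⁅x⁆ none {y} y∈p = subst (_∈ ⁅ x ⁆)
        (sym (decidable-stable (y ≟ x) λ y≢x → none (y , y∈p , y≢x))) (x∈⁅x⁆ x)

module _ {n} {P Q : Subset n → Set} where
  open import Data.Nat using (_+_)

  grow-until : (∀ {X} → P X → Q X ⊎ ∃ λ Y → P Y × ∣ X ∣ < ∣ Y ∣) →
               ∀ {X} → P X → ∃ λ Y → P Y × Q Y
  grow-until step {X} = go n (ℕP.m≤m+n n ∣ X ∣)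
    where
      go : ∀ k {X} → n ≤ k + ∣ X ∣ → P X → ∃ λ Y → P Y × Q Y
      go k _ PX with step PX
      go k     _     PX | inj₁ QX = _ , PX , QX
      go zero  n≤∣X∣ _  | inj₂ (Y , _ , ∣X∣<∣Y∣) =
        contradiction (ℕP.≤-trans (∣p∣≤n Y) n≤∣X∣) (ℕP.<⇒≱ ∣X∣<∣Y∣)
      go (suc k) {X} bound _ | inj₂ (Y , PY , ∣X∣<∣Y∣) =
        go k (ℕP.≤-trans bound (subst (_≤ k + ∣ Y ∣) (ℕP.+-suc k ∣ X ∣) (ℕP.+-monoʳ-≤ k ∣X∣<∣Y∣)))
             PY

Star-closed : ∀ {n} {F : Fin n → Fin n → Set} (A : Subset n) →
              (∀ {x y} → F x y → x ∈ A → y ∈ A) → ∀ {a b} → Star F a b → a ∈ A → b ∈ A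
Star-closed A step = fold (λ a b → a ∈ A → b ∈ A) (λ e k → k ∘ step e) id

module HomogeneousSets {n : ℕ} (E : Fin n → Fin n → Set) (E-sym : ∀ {a b} → E a b → E b a) where

  Complete Anticomplete : Fin n → Subset n → Set
  Complete     v X = ∀ x → x ∈ X → E v x
  Anticomplete v X = ∀ x → x ∈ X → ¬ E v x

  IsHomogeneous : Subset n → Set
  IsHomogeneous X = ∀ v → v ∉ X → Complete v X ⊎ Anticomplete v X

  IsHomogeneous? : (∀ a b → Dec (E a b)) → ∀ X → Dec (IsHomogeneous X)
  IsHomogeneous? E? X = all? λ v → ¬? (v ∈? X) →-dec
    (all? (λ x → x ∈? X →-dec E? v x) ⊎-dec all? (λ x → x ∈? X →-dec ¬? (E? v x)))

  module _ {X v x} (hX : IsHomogeneous X) (v∉X : v ∉ X) (x∈X : x ∈ X) where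

    complete-if-adjacent : E v x → Complete v X
    complete-if-adjacent vx with hX v v∉X
    ... | inj₁ v→X = v→X
    ... | inj₂ v↛X = contradiction vx (v↛X x x∈X)

    anticomplete-if-nonadjacent : ¬ E v x → Anticomplete v X
    anticomplete-if-nonadjacent ¬vx with hX v v∉X
    ... | inj₁ v→X = contradiction (v→X x x∈X) ¬vx
    ... | inj₂ v↛X = v↛X

  IsHomogeneous-preimage : ∀ {X} (f : Fin n → Fin n) →
    (∀ {a b} → E a b → E (f a) (f b)) → (∀ {a b} → E (f a) (f b) → E a b) →
    IsHomogeneous X → IsHomogeneous (preimage f X)
  IsHomogeneous-preimage f preserves reflects hX v v∉f⁻¹X with hX (f v) (v∉f⁻¹X ∘ ∈-preimage⁺)
  ... | inj₁ fv→X = inj₁ λ x x∈f⁻¹X → reflects (fv→X (f x) (∈-preimage⁻ x∈f⁻¹X))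
  ... | inj₂ fv↛X = inj₂ λ x x∈f⁻¹X → fv↛X (f x) (∈-preimage⁻ x∈f⁻¹X) ∘ preserves

  IsHomogeneous-∪ : ∀ {A B w} → IsHomogeneous A → IsHomogeneous B → w ∈ A → w ∈ B →
                    IsHomogeneous (A ∪ B)
  IsHomogeneous-∪ {A} {B} {w} hA hB w∈A w∈B v v∉A∪B =
    [ inj₁ ∘ complete-∪ , inj₂ ∘ anticomplete-∪ ]′ (hA v (v∉A∪B ∘ x∈p∪q⁺ ∘ inj₁))
    where
      v∉B : v ∉ B
      v∉B = v∉A∪B ∘ x∈p∪q⁺ ∘ inj₂

      complete-∪ : Complete v A → Complete v (A ∪ B)
      complete-∪ v→A x x∈A∪B =
        [ v→A x , complete-if-adjacent hB v∉B w∈B (v→A w w∈A) x ]′ (x∈p∪q⁻ A B x∈A∪B)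

      anticomplete-∪ : Anticomplete v A → Anticomplete v (A ∪ B)
      anticomplete-∪ v↛A x x∈A∪B =
        [ v↛A x , anticomplete-if-nonadjacent hB v∉B w∈B (v↛A w w∈A) x ]′ (x∈p∪q⁻ A B x∈A∪B)

  -- Every vertex outside A lies in B, where b sees all vertices or none.
  outside-uniform : ∀ {A B b} → IsHomogeneous A → IsHomogeneous B → (∀ v → v ∉ A → v ∈ B) →
                    b ∈ A → b ∉ B →
                    (∀ v → v ∉ A → Complete v A) ⊎ (∀ v → v ∉ A → Anticomplete v A)
  outside-uniform hA hB cover b∈A b∉B with hB _ b∉B
  ... | inj₁ b→B = inj₁ λ v v∉A →
    complete-if-adjacent hA v∉A b∈A (E-sym (b→B v (cover v v∉A)))
  ... | inj₂ b↛B = inj₂ λ v v∉A →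
    anticomplete-if-nonadjacent hA v∉A b∈A (b↛B v (cover v v∉A) ∘ E-sym)

  module _ (connected     : ∀ a b → Star E a b)
           (anticonnected : ∀ a b → Star (λ x y → x ≢ y × ¬ E x y) a b) where

    no-proper-cover : ∀ {A B a b} → IsHomogeneous A → IsHomogeneous B →
                      (∀ v → v ∉ A → v ∈ B) → a ∉ A → b ∉ B → ⊥
    no-proper-cover {A} {a = a} {b} hA hB cover a∉A b∉B =
      [ a∉A ∘ closed-under-nonedges , a∉A ∘ closed-under-edges ]′
        (outside-uniform hA hB cover b∈A b∉B)
      where
        b∈A : b ∈ A
        b∈A = decidable-stable (b ∈? A) (b∉B ∘ cover b)

        closed-under-nonedges : (∀ v → v ∉ A → Complete v A) → a ∈ A
        closed-under-nonedges all→A = Star-closed A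
          (λ (_ , ¬xy) x∈A → decidable-stable (_ ∈? A) λ y∉A → ¬xy (E-sym (all→A _ y∉A _ x∈A)))
          (anticonnected b a) b∈A

        closed-under-edges : (∀ v → v ∉ A → Anticomplete v A) → a ∈ A
        closed-under-edges all↛A = Star-closed A
          (λ xy x∈A → decidable-stable (_ ∈? A) λ y∉A → all↛A _ y∉A _ x∈A (E-sym xy))
          (connected b a) b∈A

    proper-homogeneous-miss : ∀ {A B a b} → IsHomogeneous A → IsHomogeneous B → a ∉ A → b ∉ B →
                              ∃ λ e → e ∉ A × e ∉ B
    proper-homogeneous-miss {A} {B} hA hB a∉A b∉B =
      decidable-stable (any? λ e → ¬? (e ∈? A) ×-dec ¬? (e ∈? B)) λ none →
        no-proper-cover hA hB (λ v v∉A → decidable-stable (v ∈? B) λ v∉B → none (v , v∉A , v∉B))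
          a∉A b∉B

module CayleyGraph {n : ℕ} (R : FiniteRing n) (U : Subset n)
  (U-subgroup : FiniteRing.IsUnitSubgroup R U)
  (-1∈U : FiniteRing.-_ R (FiniteRing.1# R) ∈ U) where

  open FiniteRing R
  open IsUnitSubgroup U-subgroup

  private
    ring : Ring 0ℓ 0ℓ
    ring = record { isRing = isRing }

  open Ring ring
    using (+-assoc; +-comm; +-identityˡ; +-identityʳ; -‿inverseʳ; *-assoc; *-identityˡ; *-identityʳ; zeroʳ)
  open RingProperties ring
    using (-1*x≈-x; ⁻¹-anti-homo‿-; -‿+-comm; -0#≈0#; x[y-z]≈xy-xz; x∙y⁻¹≈ε⇒x≈y
          ; //-rightDividesˡ; //-rightDividesʳ)

  [x+z]-[y+z]≡x-y : ∀ x y z → (x + z) - (y + z) ≡ x - y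
  [x+z]-[y+z]≡x-y x y z = begin
    (x + z) + - (y + z)    ≡⟨ cong ((x + z) +_) (trans (sym (-‿+-comm y z)) (+-comm (- y) (- z))) ⟩
    (x + z) + (- z + - y)  ≡⟨ sym (+-assoc (x + z) (- z) (- y)) ⟩
    ((x + z) - z) + - y    ≡⟨ cong (_- y) (//-rightDividesʳ z x) ⟩
    x - y                  ∎
    where open ≡-Reasoning

  xy≡1⇒x[yz]≡z : ∀ {x y} z → x * y ≡ 1# → x * (y * z) ≡ z
  xy≡1⇒x[yz]≡z {x} {y} z xy≡1 =
    trans (sym (*-assoc x y z)) (trans (cong (_* z) xy≡1) (*-identityˡ z))

  inverse∈U : ∀ {u} → u ∈ U → ∃ λ v → v ∈ U × u * v ≡ 1# × v * u ≡ 1#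
  inverse∈U {u} u∈U = let v , uv≡1 , vu≡1 = units u u∈U in v , inv∈ u v u∈U uv≡1 vu≡1 , uv≡1 , vu≡1

  Adj-sym : ∀ {a b} → Adj R U a b → Adj R U b a
  Adj-sym {a} {b} a-b∈U =
    subst (_∈ U) (trans (-1*x≈-x (a - b)) (⁻¹-anti-homo‿- a b)) (mul∈ _ _ -1∈U a-b∈U)

  Adj? : ∀ a b → Dec (Adj R U a b)
  Adj? a b = (a - b) ∈? U

  open HomogeneousSets (Adj R U) Adj-sym

  translate-homogeneous : ∀ {X} k → IsHomogeneous X → IsHomogeneous (preimage (_+ k) X)
  translate-homogeneous k = IsHomogeneous-preimage (_+ k)
    (subst (_∈ U) (sym ([x+z]-[y+z]≡x-y _ _ k))) (subst (_∈ U) ([x+z]-[y+z]≡x-y _ _ k))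

  Adj-*ˡ : ∀ {u a b} → u ∈ U → Adj R U a b → Adj R U (u * a) (u * b)
  Adj-*ˡ {u} {a} {b} u∈U = subst (_∈ U) (x[y-z]≈xy-xz u a b) ∘ mul∈ _ _ u∈U

  scale-homogeneous : ∀ {X v} → v ∈ U → IsHomogeneous X → IsHomogeneous (preimage (v *_) X)
  scale-homogeneous {v = v} v∈U = IsHomogeneous-preimage (v *_) (Adj-*ˡ v∈U) reflects
    where
      reflects : ∀ {a b} → Adj R U (v * a) (v * b) → Adj R U a b
      reflects {a} {b} =
        let u , u∈U , _ , uv≡1 = inverse∈U v∈U
        in subst₂ (Adj R U) (xy≡1⇒x[yz]≡z a uv≡1) (xy≡1⇒x[yz]≡z b uv≡1) ∘ Adj-*ˡ u∈U

  record NontrivialHomogeneous₀ (X : Subset n) : Set where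
    field
      homogeneous : IsHomogeneous X
      0∈X         : 0# ∈ X
      d           : Fin n
      d∈X         : d ∈ X
      d≢0         : d ≢ 0#
      c           : Fin n
      c∉X         : c ∉ X

  record IsUSubmodule (X : Subset n) : Set where
    field
      +-closed : ∀ {a b} → a ∈ X → b ∈ X → a + b ∈ X
      *-closed : ∀ {u a} → u ∈ U → a ∈ X → u * a ∈ X

  Larger : Subset n → Set
  Larger X = ∃ λ Y → NontrivialHomogeneous₀ Y × ∣ X ∣ < ∣ Y ∣

  ¬prime⇒nontrivialHomogeneous : ¬ Prime R U → ∃ λ X → IsHomogeneous X × NonTrivial R U X
  ¬prime⇒nontrivialHomogeneous ¬prime = decidable-stable
    (anySubset? λ X → IsHomogeneous? Adj? X ×-dec 2 ≤? ∣ X ∣ ×-dec ∣ X ∣ <? n) ¬prime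

  nontrivial⇒nontrivialHomogeneous₀ : ∀ {X} → IsHomogeneous X → NonTrivial R U X →
                                      ∃ NontrivialHomogeneous₀
  nontrivial⇒nontrivialHomogeneous₀ {X} hX (1<∣X∣ , ∣X∣<n)
    with x , x∈X     ← 0<∣p∣⇒nonempty (ℕP.≤-trans (s≤s z≤n) 1<∣X∣)
    with y , y∈X , y≢x ← 1<∣p∣⇒∃≢ 1<∣X∣ x
    with e , e∉X     ← ∣p∣<n⇒∃∉ ∣X∣<n
    = preimage (_+ x) X , record
      { homogeneous = translate-homogeneous x hX
      ; 0∈X         = ∈-preimage⁺ (subst (_∈ X) (sym (+-identityˡ x)) x∈X)
      ; d           = y - x
      ; d∈X         = ∈-preimage⁺ (subst (_∈ X) (sym (//-rightDividesˡ x y)) y∈X)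
      ; d≢0         = y≢x ∘ x∙y⁻¹≈ε⇒x≈y y x
      ; c           = e - x
      ; c∉X         = e∉X ∘ subst (_∈ X) (//-rightDividesˡ x e) ∘ ∈-preimage⁻
      }

  module _ (connected : Connected R U) (anticonnected : AntiConnected R U) where

    absorb : ∀ {X T w c′ z} → NontrivialHomogeneous₀ X → IsHomogeneous T →
             w ∈ X → w ∈ T → c′ ∉ T → z ∈ T → z ∉ X → Larger X
    absorb {X} {T} {z = z} hX hT w∈X w∈T c′∉T z∈T z∉X
      with e , e∉X , e∉T ← proper-homogeneous-miss connected anticonnected
                             (NontrivialHomogeneous₀.homogeneous hX) hT
                             (NontrivialHomogeneous₀.c∉X hX) c′∉T
      = X ∪ T , record
        { homogeneous = IsHomogeneous-∪ homogeneous hT w∈X w∈T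
        ; 0∈X         = x∈p∪q⁺ (inj₁ 0∈X)
        ; d           = d
        ; d∈X         = x∈p∪q⁺ (inj₁ d∈X)
        ; d≢0         = d≢0
        ; c           = e
        ; c∉X         = [ e∉X , e∉T ]′ ∘ x∈p∪q⁻ X T
        }
      , p⊂q⇒∣p∣<∣q∣ (p⊆p∪q T , z , x∈p∪q⁺ (inj₂ z∈T) , z∉X)
      where open NontrivialHomogeneous₀ hX

    +-violation : ∀ {X a b} → NontrivialHomogeneous₀ X → a ∈ X → b ∈ X → a + b ∉ X → Larger X
    +-violation {X} {a} {b} hX a∈X b∈X a+b∉X =
      absorb hX (translate-homogeneous (- b) homogeneous) b∈X
        (∈-preimage⁺ (subst (_∈ X) (sym (-‿inverseʳ b)) 0∈X))
        (c∉X ∘ subst (_∈ X) (//-rightDividesʳ b c) ∘ ∈-preimage⁻)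
        (∈-preimage⁺ (subst (_∈ X) (sym (//-rightDividesʳ b a)) a∈X))
        a+b∉X
      where open NontrivialHomogeneous₀ hX

    *-violation : ∀ {X u a} → NontrivialHomogeneous₀ X → u ∈ U → a ∈ X → u * a ∉ X → Larger X
    *-violation {X} {u} {a} hX u∈U a∈X ua∉X
      with v , v∈U , _ , vu≡1 ← inverse∈U u∈U
      = absorb hX (scale-homogeneous v∈U homogeneous) 0∈X
          (∈-preimage⁺ (subst (_∈ X) (sym (zeroʳ v)) 0∈X))
          (c∉X ∘ subst (_∈ X) (xy≡1⇒x[yz]≡z c vu≡1) ∘ ∈-preimage⁻)
          (∈-preimage⁺ (subst (_∈ X) (sym (xy≡1⇒x[yz]≡z a vu≡1)) a∈X))
          ua∉X
      where open NontrivialHomogeneous₀ hX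

    closed-or-larger : ∀ {X} → NontrivialHomogeneous₀ X → IsUSubmodule X ⊎ Larger X
    closed-or-larger {X} hX
      with any? (λ a → any? λ b → a ∈? X ×-dec b ∈? X ×-dec ¬? ((a + b) ∈? X))
    ... | yes (a , b , a∈X , b∈X , a+b∉X) = inj₂ (+-violation hX a∈X b∈X a+b∉X)
    ... | no no-+-violation
      with any? (λ u → any? λ a → u ∈? U ×-dec a ∈? X ×-dec ¬? ((u * a) ∈? X))
    ...   | yes (u , a , u∈U , a∈X , ua∉X) = inj₂ (*-violation hX u∈U a∈X ua∉X)
    ...   | no no-*-violation = inj₁ record
      { +-closed = λ {a} {b} a∈X b∈X → decidable-stable ((a + b) ∈? X) λ a+b∉X →
          no-+-violation (a , b , a∈X , b∈X , a+b∉X)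
      ; *-closed = λ {u} {a} u∈U a∈X → decidable-stable ((u * a) ∈? X) λ ua∉X →
          no-*-violation (u , a , u∈U , a∈X , ua∉X)
      }

    module _ {M} (hM : NontrivialHomogeneous₀ M) (sM : IsUSubmodule M) where
      open NontrivialHomogeneous₀ hM
      open IsUSubmodule sM

      -- A unit in M puts 1, hence all of U, into M; then M is closed along edges
      -- and connectedness forces c ∈ M.
      ∈U⇒∉M : ∀ {u} → u ∈ U → u ∉ M
      ∈U⇒∉M u∈U u∈M = c∉X (Star-closed M step (connected 0# c) 0∈X)
        where
          1∈M : 1# ∈ M
          1∈M = let v , v∈U , _ , vu≡1 = inverse∈U u∈U in subst (_∈ M) vu≡1 (*-closed v∈U u∈M)

          step : ∀ {a b} → Adj R U a b → a ∈ M → b ∈ M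
          step {a} {b} a-b∈U a∈M = subst (_∈ M) (//-rightDividesˡ a b)
            (+-closed (subst (_∈ M) (*-identityʳ (b - a)) (*-closed (Adj-sym a-b∈U) 1∈M)) a∈M)

      d-0-twins : ∀ a → Adj R U a d ⇔ Adj R U a 0#
      d-0-twins a with a ∈? M
      ... | yes a∈M = mk⇔ (λ a-d∈U → contradiction a-d∈M (∈U⇒∉M a-d∈U))
                          (λ a-0∈U → contradiction a-0∈M (∈U⇒∉M a-0∈U))
        where
          a-d∈M : a - d ∈ M
          a-d∈M = +-closed a∈M (subst (_∈ M) (-1*x≈-x d) (*-closed -1∈U d∈X))

          a-0∈M : a - 0# ∈ M
          a-0∈M = subst (_∈ M) (sym (trans (cong (a +_) -0#≈0#) (+-identityʳ a))) a∈M
      ... | no a∉M with homogeneous a a∉M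
      ...   | inj₁ a→M = mk⇔ (λ _ → a→M 0# 0∈X) (λ _ → a→M d d∈X)
      ...   | inj₂ a↛M = mk⇔ (⊥-elim ∘ a↛M d d∈X) (⊥-elim ∘ a↛M 0# 0∈X)

mainTheorem14 : (n : ℕ) (R : FiniteRing n) (U : Subset n) →
    FiniteRing.IsUnitSubgroup R U →
    FiniteRing.-_ R (FiniteRing.1# R) ∈ U →
    Connected R U → AntiConnected R U → ¬ Prime R U →
    ZeroIsEigenvalue R U
mainTheorem14 n R U U-subgroup -1∈U connected anticonnected ¬prime =
  let X , hX , X-nontrivial = ¬prime⇒nontrivialHomogeneous ¬prime
      _ , X₀                = nontrivial⇒nontrivialHomogeneous₀ hX X-nontrivial
      _ , M₀ , M-closed     = grow-until (closed-or-larger connected anticonnected) X₀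
  in twins⇒zeroIsEigenvalue R U (NontrivialHomogeneous₀.d≢0 M₀)
       (d-0-twins connected anticonnected M₀ M-closed)
  where open CayleyGraph R U U-subgroup -1∈U
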